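{- Let $\mathcal T,\mathcal T'$ be topologies on a finite set $X$ such that $\mathcal T'$ is $\mathcal T$-admissible (in particular $\mathcal T'\prec\mathcal T$). Then for all $x,y\in X$: $x\sim_{\mathcal T'}y\iff x\sim_{\mathcal T}y$.
   Context: For a topology $\mathcal T$ on a finite set $X$, the associated quasi-order is $x\le_{\mathcal T}y$ iff every open set containing $x$ contains $y$; topologies correspond bijectively to quasi-orders, open sets being final segments. Write $x\sim_{\mathcal T}y$ iff $x\le_{\mathcal T}y$ and $y\le_{\mathcal T}x$. Write $\mathcal T'\prec\mathcal T$ when every $\mathcal T$-open set is $\mathcal T'$-open (equivalently $x\le_{\mathcal T'}y\Rightarrow x\le_{\mathcal T}y$). For $\mathcal T'\prec\mathcal T$, the quotient $\mathcal T/\mathcal T'$ is the topology on $X$ whose quasi-order is the transitive closure of $x\,\mathcal R\,y\iff(x\le_{\mathcal T}y\text{ or }y\le_{\mathcal T'}x)$. For $Y\subset X$, the restriction is $\mathcal T|_Y=\{Z\cap Y: Z\in\mathcal T\}$; $Y$ is $\mathcal T$-connected if $(Y,\mathcal T|_Y)$ is connected. $\mathcal T'$ is called $\mathcal T$-admissible if $\mathcal T'\prec\mathcal T$, $\mathcal T'|_Y=\mathcal T|_Y$ for every $\mathcal T'$-connected subset $Y\subset X$, and for all $x,y\in X$, $x\sim_{\mathcal T/\mathcal T'}y\iff x\sim_{\mathcal T'/\mathcal T'}y$. -}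

module Defs where

open import Level using (0ℓ)
open import Data.Nat using (ℕ)
open import Data.Fin using (Fin)
open import Data.Fin.Subset using (Subset; _∈_; _∩_; _∪_; ⊤; Nonempty) renaming (⊥ to ∅)
open import Data.Product using (Σ; ∃; _×_; _,_)
open import Data.Sum using (_⊎_)
open import Relation.Nullary using (¬_)
open import Relation.Binary.PropositionalEquality using (_≡_)
open import Relation.Binary.Construct.Closure.Transitive using (TransClosure)
open import Function.Bundles using (_⇔_)

-- A topology on a finite set: a family of subsets containing ∅ and X and
-- closed under (binary, hence all finite = all) unions and intersections.
record Topology (n : ℕ) : Set₁ where
  field
    Open      : Subset n → Set
    ∅-open    : Open ∅
    ⊤-open    : Open ⊤
    ∪-open    : ∀ {U V} → Open U → Open V → Open (U ∪ V)
    ∩-open    : ∀ {U V} → Open U → Open V → Open (U ∩ V)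
open Topology public

module _ {n : ℕ} where

  _≤[_]_ : Fin n → Topology n → Fin n → Set
  x ≤[ T ] y = ∀ U → Open T U → x ∈ U → y ∈ U

  _∼[_]_ : Fin n → Topology n → Fin n → Set
  x ∼[ T ] y = (x ≤[ T ] y) × (y ≤[ T ] x)

  _≺_ : Topology n → Topology n → Set
  T' ≺ T = ∀ U → Open T U → Open T' U

  QuotRel : Topology n → Topology n → Fin n → Fin n → Set
  QuotRel T T' x y = (x ≤[ T ] y) ⊎ (y ≤[ T' ] x)

  _≤Quot[_/_]_ : Fin n → Topology n → Topology n → Fin n → Set
  x ≤Quot[ T / T' ] y = TransClosure (QuotRel T T') x y

  _∼Quot[_/_]_ : Fin n → Topology n → Topology n → Fin n → Set
  x ∼Quot[ T / T' ] y = (x ≤Quot[ T / T' ] y) × (y ≤Quot[ T / T' ] x)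

  RestrOpen : Topology n → Subset n → Subset n → Set
  RestrOpen T Y W = ∃ λ Z → Open T Z × (W ≡ Z ∩ Y)

  Connected : Topology n → Subset n → Set
  Connected T Y =
    ¬ (Σ (Subset n) λ U → Σ (Subset n) λ V →
         RestrOpen T Y U × RestrOpen T Y V × Nonempty U × Nonempty V ×
         (U ∩ V ≡ ∅) × (U ∪ V ≡ Y))

  SameRestriction : Topology n → Topology n → Subset n → Set
  SameRestriction T T' Y = ∀ W → RestrOpen T Y W ⇔ RestrOpen T' Y W

  record Admissible (T T' : Topology n) : Set₁ where
    field
      prec       : T' ≺ T
      restr      : ∀ Y → Connected T' Y → SameRestriction T' T Y
      quot-equiv : ∀ x y → (x ∼Quot[ T / T' ] y) ⇔ (x ∼Quot[ T' / T' ] y)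

-- Coarsening T to T' can only merge points, so ∼_T' ⊆ ∼_T.  Conversely, if
-- x ∼_T y then x ∼_{T/T'} y, and admissibility turns this into x ∼_{T'/T'} y:
-- a zigzag x = a₀, a₁, …, a_k = y of ≤_T'-comparable neighbours.  The points
-- of such a zigzag form a T'-connected set Y, on which T and T' restrict to
-- the same topology, so the T-comparisons x ≤_T y and y ≤_T x, which live
-- inside Y, are T'-comparisons as well.
module Submission where

open import Defs
open import Data.Nat using (ℕ)
open import Data.Fin using (Fin)
open import Data.Fin.Subset using (Subset; Nonempty; _∈_; _∩_; _∪_; _⊆_; ⁅_⁆) renaming (⊥ to ∅)
open import Data.Fin.Subset.Properties
  using (∩-comm; ∪-comm; ∉⊥; x∈⁅x⁆; x∈⁅y⁆⇒x≡y; x∈p∩q⁺; x∈p∩q⁻; x∈p∪q⁺; x∈p∪q⁻)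
open import Data.Product using (_,_; proj₁; proj₂; map)
open import Data.Sum using (_⊎_; inj₁; inj₂)
open import Data.Empty using (⊥; ⊥-elim)
open import Relation.Binary.PropositionalEquality using (_≡_; refl; subst; sym; trans)
open import Relation.Binary.Construct.Closure.Transitive using (TransClosure; [_]; _∷_)
open import Function.Bundles using (_⇔_; mk⇔; Equivalence)

private
  variable
    n : ℕ
    T : Topology n
    Y U V : Subset n
    x y : Fin n

≺⇒≤ : ∀ T' T → T' ≺ T → x ≤[ T' ] y → x ≤[ T ] y
≺⇒≤ _ _ T'≺T x≤y W W-open = x≤y W (T'≺T W W-open)

≤⇒≤Quot : ∀ T T' → x ≤[ T ] y → x ≤Quot[ T / T' ] y
≤⇒≤Quot _ _ x≤y = [ inj₁ x≤y ]

RestrOpen⇒⊆ : ∀ T → RestrOpen T Y U → U ⊆ Y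
RestrOpen⇒⊆ {Y = Y} _ (Z , _ , refl) x∈U = proj₂ (x∈p∩q⁻ Z Y x∈U)

RestrOpen⇒upward : ∀ T → RestrOpen T Y U → x ∈ U → x ≤[ T ] y → y ∈ Y → y ∈ U
RestrOpen⇒upward {Y = Y} _ (Z , Z-open , refl) x∈U x≤y y∈Y =
  x∈p∩q⁺ (x≤y Z Z-open (proj₁ (x∈p∩q⁻ Z Y x∈U)) , y∈Y)

SameRestriction⇒≤ : ∀ T' T → SameRestriction T' T Y → x ∈ Y → y ∈ Y → x ≤[ T ] y → x ≤[ T' ] y
SameRestriction⇒≤ {Y = Y} {x = x} {y = y} _ _ same x∈Y y∈Y x≤y W W-open x∈W
  with Equivalence.to (same (W ∩ Y)) (W , W-open , refl)
... | Z , Z-open , W∩Y≡Z∩Y = proj₁ (x∈p∩q⁻ W Y y∈W∩Y)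
  where
  x∈Z : x ∈ Z
  x∈Z = proj₁ (x∈p∩q⁻ Z Y (subst (x ∈_) W∩Y≡Z∩Y (x∈p∩q⁺ (x∈W , x∈Y))))
  y∈W∩Y : y ∈ W ∩ Y
  y∈W∩Y = subst (y ∈_) (sym W∩Y≡Z∩Y) (x∈p∩q⁺ (x≤y Z Z-open x∈Z , y∈Y))

module _ {_~_ : Fin n → Fin n → Set} where

  support : TransClosure _~_ x y → Subset n
  support {x = x} {y = y} [ _ ] = ⁅ x ⁆ ∪ ⁅ y ⁆
  support {x = x}     (_ ∷ c) = ⁅ x ⁆ ∪ support c

  head∈support : (c : TransClosure _~_ x y) → x ∈ support c
  head∈support {x = x} [ _ ]   = x∈p∪q⁺ (inj₁ (x∈⁅x⁆ x))
  head∈support {x = x} (_ ∷ _) = x∈p∪q⁺ (inj₁ (x∈⁅x⁆ x))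

  last∈support : (c : TransClosure _~_ x y) → y ∈ support c
  last∈support {y = y} [ _ ] = x∈p∪q⁺ (inj₂ (x∈⁅x⁆ y))
  last∈support (_ ∷ c)       = x∈p∪q⁺ (inj₂ (last∈support c))

  step-closed⇒support⊆ : (∀ {w v} → w ∈ U → w ~ v → v ∈ Y → v ∈ U) →
                         (c : TransClosure _~_ x y) → support c ⊆ Y → x ∈ U → support c ⊆ U
  step-closed⇒support⊆ {x = x} {y = y} step [ r ] c⊆Y x∈U w∈c
    with x∈p∪q⁻ ⁅ x ⁆ ⁅ y ⁆ w∈c
  ... | inj₁ w∈⁅x⁆ rewrite x∈⁅y⁆⇒x≡y x w∈⁅x⁆ = x∈U
  ... | inj₂ w∈⁅y⁆ rewrite x∈⁅y⁆⇒x≡y y w∈⁅y⁆ = step x∈U r (c⊆Y (last∈support [ r ]))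
  step-closed⇒support⊆ {Y = Y} {x = x} step (r ∷ c) rc⊆Y x∈U w∈rc
    with x∈p∪q⁻ ⁅ x ⁆ (support c) w∈rc
  ... | inj₁ w∈⁅x⁆ rewrite x∈⁅y⁆⇒x≡y x w∈⁅x⁆ = x∈U
  ... | inj₂ w∈c = step-closed⇒support⊆ step c c⊆Y (step x∈U r (c⊆Y (head∈support c))) w∈c
    where
    c⊆Y : support c ⊆ Y
    c⊆Y w∈c = rc⊆Y (x∈p∪q⁺ (inj₂ w∈c))

record Separation (T : Topology n) (Y U V : Subset n) : Set where
  field
    U-open   : RestrOpen T Y U
    V-open   : RestrOpen T Y V
    disjoint : U ∩ V ≡ ∅
    covers   : U ∪ V ≡ Y

  ∈U⇒∉V : x ∈ U → x ∈ V → ⊥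
  ∈U⇒∉V {x = x} x∈U x∈V = ∉⊥ (subst (x ∈_) disjoint (x∈p∩q⁺ (x∈U , x∈V)))

  ∈Y⇒∈U⊎∈V : x ∈ Y → x ∈ U ⊎ x ∈ V
  ∈Y⇒∈U⊎∈V {x = x} x∈Y = x∈p∪q⁻ U V (subst (x ∈_) (sym covers) x∈Y)

  swap : Separation T Y V U
  swap = record { U-open = V-open ; V-open = U-open
                ; disjoint = trans (∩-comm V U) disjoint
                ; covers = trans (∪-comm V U) covers }

  step-within-U : x ∈ U → QuotRel T T x y → y ∈ Y → y ∈ U
  step-within-U x∈U (inj₁ x≤y) y∈Y = RestrOpen⇒upward T U-open x∈U x≤y y∈Y
  step-within-U x∈U (inj₂ y≤x) y∈Y with ∈Y⇒∈U⊎∈V y∈Y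
  ... | inj₁ y∈U = y∈U
  ... | inj₂ y∈V =
    ⊥-elim (∈U⇒∉V x∈U (RestrOpen⇒upward T V-open y∈V y≤x (RestrOpen⇒⊆ T U-open x∈U)))

support-stays-in : (c : x ≤Quot[ T / T ] y) → Separation T (support c) U V →
                   x ∈ U → support c ⊆ U
support-stays-in c sep = step-closed⇒support⊆ (Separation.step-within-U sep) c (λ w∈c → w∈c)

support-unseparated : (c : x ≤Quot[ T / T ] y) → Separation T (support c) U V →
                      Nonempty U → Nonempty V → ⊥
support-unseparated {T = T} c sep (u , u∈U) (v , v∈V)
  with Separation.∈Y⇒∈U⊎∈V sep (head∈support c)
... | inj₁ x∈U = ∈U⇒∉V (support-stays-in c sep x∈U (RestrOpen⇒⊆ T V-open v∈V)) v∈V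
  where open Separation sep
... | inj₂ x∈V = ∈U⇒∉V u∈U (support-stays-in c swap x∈V (RestrOpen⇒⊆ T U-open u∈U))
  where open Separation sep

support-connected : (c : x ≤Quot[ T / T ] y) → Connected T (support c)
support-connected {T = T} c (U , V , U-open , V-open , U≠∅ , V≠∅ , U∩V≡∅ , U∪V≡Y) =
  support-unseparated {T = T} c separation U≠∅ V≠∅
  where
  separation : Separation T (support c) U V
  separation = record { U-open = U-open ; V-open = V-open
                      ; disjoint = U∩V≡∅ ; covers = U∪V≡Y }

lemma2p3 : (n : ℕ) (T T' : Topology n) → Admissible T T' →
    ∀ (x y : Fin n) → (x ∼[ T' ] y) ⇔ (x ∼[ T ] y)
lemma2p3 n T T' adm x y = mk⇔ (map (≺⇒≤ T' T prec) (≺⇒≤ T' T prec)) T-equiv⇒T'-equiv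
  where
  open Admissible adm
  T-equiv⇒T'-equiv : x ∼[ T ] y → x ∼[ T' ] y
  T-equiv⇒T'-equiv (x≤y , y≤x)
    with Equivalence.to (quot-equiv x y) (≤⇒≤Quot T T' x≤y , ≤⇒≤Quot T T' y≤x)
  ... | zigzag , _ =
    SameRestriction⇒≤ T' T same (head∈support zigzag) (last∈support zigzag) x≤y ,
    SameRestriction⇒≤ T' T same (last∈support zigzag) (head∈support zigzag) y≤x
    where
    same : SameRestriction T' T (support zigzag)
    same = restr (support zigzag) (support-connected {T = T'} zigzag)
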